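{- For every finite simple $6$-regular graph $G$, $\mathrm{Maj}'(G)\le 3$.
   Context: Two distinct edges are adjacent if they share an endpoint. An edge-coloring $c:E\to C$ (not necessarily proper) of a graph $G=(V,E)$ is a strong majority edge-coloring if for every edge $e\in E$ and every color $\alpha\in C$, at most half of the edges adjacent to $e$ have color $\alpha$. The strong majority index $\mathrm{Maj}'(G)$ is the least number of colors in such a coloring. -}

module Defs where

open import Data.Nat using (ℕ; _+_; _*_; _≤_)
open import Data.Fin using (Fin)
open import Data.Fin.Properties using (_≟_)
open import Data.List using (List; length; filter)
open import Data.List using () renaming (allFin to allFinL)
open import Data.Product using (_×_; Σ)
open import Relation.Nullary using (¬_; Dec)
open import Relation.Nullary.Decidable using (_×-dec_; ¬?)
open import Relation.Binary.PropositionalEquality using (_≡_)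

record SimpleGraph (n : ℕ) : Set₁ where
  field
    Adj      : Fin n → Fin n → Set
    adj?     : (u v : Fin n) → Dec (Adj u v)
    sym      : ∀ {u v} → Adj u v → Adj v u
    irrefl   : ∀ {u} → ¬ Adj u u

open SimpleGraph public

neighbours : ∀ {n} → SimpleGraph n → Fin n → List (Fin n)
neighbours G u = filter (adj? G u) (allFinL _)

degree : ∀ {n} → SimpleGraph n → Fin n → ℕ
degree G u = length (neighbours G u)

Regular : ∀ {n} → ℕ → SimpleGraph n → Set
Regular d G = ∀ u → degree G u ≡ d

-- An edge-coloring with colours in Fin k: a colour for every pair of
-- vertices, symmetric; only its values on edges matter.
record EdgeColoring {n} (G : SimpleGraph n) (k : ℕ) : Set where
  field
    col  : Fin n → Fin n → Fin k
    symm : ∀ u v → col u v ≡ col v u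

open EdgeColoring public

-- Edges adjacent to the edge uv which are incident to u: the edges uw with
-- w a neighbour of u, w ≠ v.
othersAt : ∀ {n} → SimpleGraph n → Fin n → Fin n → List (Fin n)
othersAt G u v = filter (λ w → ¬? (w ≟ v)) (neighbours G u)

-- number of edges adjacent to uv (edges uw, w≠v, and vw, w≠u; these are
-- all distinct in a simple graph)
adjCount : ∀ {n} → SimpleGraph n → Fin n → Fin n → ℕ
adjCount G u v = length (othersAt G u v) + length (othersAt G v u)

adjColCount : ∀ {n k} (G : SimpleGraph n) → EdgeColoring G k →
              Fin k → Fin n → Fin n → ℕ
adjColCount G c α u v =
  length (filter (λ w → col c u w ≟ α) (othersAt G u v)) +
  length (filter (λ w → col c v w ≟ α) (othersAt G v u))

StrongMajority : ∀ {n k} (G : SimpleGraph n) → EdgeColoring G k → Set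
StrongMajority G c = ∀ u v → Adj G u v → ∀ α →
  2 * adjColCount G c α u v ≤ adjCount G u v

-- Maj'(G) ≤ k  iff  there is a strong majority edge-colouring with at most
-- k colours (equivalently with colour set Fin k; unused colours are harmless)
MajIndexAtMost : ∀ {n} → SimpleGraph n → ℕ → Set
MajIndexAtMost G k = Σ (EdgeColoring G k) (StrongMajority G)

-- A finite graph has a balanced orientation (in- and out-degree differ by at most one at every
-- vertex): while some vertex v has at least two more out- than in-edges, walk from v along unused
-- out-edges until stuck; the walk ends at a vertex with more in- than out-edges, and reversing it
-- lowers the sum of |out − in|. In a 6-regular graph such an orientation has out = in = 3, so
-- splitting every vertex into an out-copy and an in-copy gives a bipartite graph of maximum degree 3.
-- By Kőnig's theorem it has a proper 3-edge-colouring (a Kempe step re-balances two colour classes,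
-- again through a balanced orientation), and back in G every colour occurs at most twice at each
-- vertex. So an edge uv has at most 2 + 2 of its 10 adjacent edges in any one colour.

module Submission where

open import Defs hiding (sym)

open import Data.Bool using (Bool; true; false; not; _∧_; _∨_; _xor_; if_then_else_)
import Data.Bool.Properties as Bool
open import Data.Bool.Properties using (not-involutive; not-distribʳ-xor; ∧-zeroʳ; ∧-identityʳ; ∨-comm; ∧-comm; ∧-abs-∨; T-≡)
open import Data.Empty using (⊥-elim)
open import Data.Fin using (Fin; zero)
import Data.Fin.Properties as Fin
open import Data.List using (List; []; _∷_; length; map; filter; allFin; cartesianProduct)
open import Data.List.Membership.Propositional using (_∈_)
open import Data.List.Membership.Propositional.Properties using (∈-allFin; ∈-filter⁺; ∈-filter⁻; ∈-map⁺; ∈-map⁻; ∈-cartesianProduct⁺)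
open import Data.List.Properties using (length-map; length-tabulate; map-cong)
import Data.List.Relation.Unary.All as All
open import Data.List.Relation.Unary.All.Properties using (¬All⇒Any¬)
open import Data.List.Relation.Unary.AllPairs using (_∷_)
open import Data.List.Relation.Unary.Any using (here; there; satisfied)
open import Data.List.Relation.Unary.Unique.Propositional using (Unique)
import Data.List.Relation.Unary.Unique.Propositional.Properties as Unique
open import Data.Nat using (ℕ; zero; suc; _+_; _*_; _≤_; _<_; z≤n; s≤s; ∣_-_∣; _≤?_; _≡ᵇ_)
import Data.Nat as ℕ
open import Data.Nat.Induction using (<-wellFounded)
open import Data.Nat.ListAction using (sum)
open import Data.Nat.Properties
  using ( +-assoc; +-comm; +-suc; +-identityʳ; +-cancelʳ-≡; +-cancelʳ-≤; +-cancelʳ-<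
        ; +-mono-≤; +-mono-<-≤; +-mono-≤-<; +-monoʳ-≤; +-monoʳ-<; *-identityʳ; *-zeroʳ; *-monoʳ-≤
        ; ≤-refl; ≤-reflexive; ≤-trans; ≤-pred; <⇒≤; <⇒≱; ≰⇒>; 1+n≰n; n≤1+n; m≤m+n; m<n+m; n≢0⇒n>0
        ; suc-injective; ∣-∣-comm; ∣-∣-identityʳ; +-commutativeSemigroup; module ≤-Reasoning )
open import Algebra.Properties.CommutativeSemigroup +-commutativeSemigroup using (interchange; x∙yz≈y∙xz; xy∙z≈zy∙x; xy∙z≈xz∙y)
open import Data.Product using (Σ; ∃; _×_; _,_; proj₁; proj₂)
open import Data.Product.Properties using (≡-dec)
open import Data.Sum using (_⊎_; inj₁; inj₂)
open import Function using (_∘_; Equivalence)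
open import Induction.WellFounded using (Acc; acc)
open import Relation.Binary.Definitions using (DecidableEquality; tri<; tri≈; tri>)
open import Relation.Binary.PropositionalEquality using (_≡_; _≢_; refl; sym; trans; cong; cong₂; subst; module ≡-Reasoning)
open import Relation.Nullary using (¬_; Dec; does; yes; no)
open import Relation.Nullary.Decidable using (dec-true; dec-false; T?; ¬?; _×-dec_)

𝟙 : Bool → ℕ
𝟙 true  = 1
𝟙 false = 0

private
  variable
    A B : Set

∧-true⁻ : ∀ {a b} → a ∧ b ≡ true → a ≡ true × b ≡ true
∧-true⁻ {true} {true} _ = refl , refl

not-true⁻ : ∀ {a} → not a ≡ true → a ≡ false
not-true⁻ {false} _ = refl

∨-false⁻ : ∀ {a b} → a ∨ b ≡ false → a ≡ false × b ≡ false
∨-false⁻ {false} {false} _ = refl , refl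

count : (A → Bool) → List A → ℕ
count P []       = 0
count P (x ∷ xs) = 𝟙 (P x) + count P xs

count-false : ∀ (xs : List A) → count (λ _ → false) xs ≡ 0
count-false []       = refl
count-false (x ∷ xs) = count-false xs

count-cong : ∀ {P Q : A → Bool} xs → (∀ {x} → x ∈ xs → P x ≡ Q x) → count P xs ≡ count Q xs
count-cong []       P≡Q = refl
count-cong (x ∷ xs) P≡Q = cong₂ _+_ (cong 𝟙 (P≡Q (here refl))) (count-cong xs (P≡Q ∘ there))

count-mono : ∀ {P Q : A → Bool} xs → (∀ {x} → x ∈ xs → P x ≡ true → Q x ≡ true) →
             count P xs ≤ count Q xs
count-mono []       P⇒Q = z≤n
count-mono {P = P} {Q = Q} (x ∷ xs) P⇒Q = +-mono-≤ (𝟙-mono (P x) (Q x) (P⇒Q (here refl))) (count-mono xs (P⇒Q ∘ there))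
  where
  𝟙-mono : ∀ a b → (a ≡ true → b ≡ true) → 𝟙 a ≤ 𝟙 b
  𝟙-mono false b a⇒b = z≤n
  𝟙-mono true  b a⇒b rewrite a⇒b refl = ≤-refl

count-split : ∀ (P Q : A → Bool) xs →
              count P xs ≡ count (λ x → Q x ∧ P x) xs + count (λ x → not (Q x) ∧ P x) xs
count-split P Q []       = refl
count-split P Q (x ∷ xs) with Q x
... | true  = trans (cong (𝟙 (P x) +_) (count-split P Q xs)) (sym (+-assoc (𝟙 (P x)) _ _))
... | false = trans (cong (𝟙 (P x) +_) (count-split P Q xs)) (x∙yz≈y∙xz (𝟙 (P x)) (count (λ y → Q y ∧ P y) xs) _)

count-complement : ∀ (P : A → Bool) xs → count P xs + count (not ∘ P) xs ≡ length xs
count-complement P []       = refl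
count-complement P (x ∷ xs) with P x
... | true  = cong suc (count-complement P xs)
... | false = trans (+-suc (count P xs) _) (cong suc (count-complement P xs))

count-map : ∀ (P : B → Bool) (f : A → B) xs → count P (map f xs) ≡ count (P ∘ f) xs
count-map P f []       = refl
count-map P f (x ∷ xs) = cong (𝟙 (P (f x)) +_) (count-map P f xs)

count-filter : ∀ {R : A → Set} (R? : ∀ x → Dec (R x)) (P : A → Bool) xs →
               count P (filter R? xs) ≡ count (λ x → does (R? x) ∧ P x) xs
count-filter R? P []       = refl
count-filter R? P (x ∷ xs) with does (R? x)
... | true  = cong (𝟙 (P x) +_) (count-filter R? P xs)
... | false = count-filter R? P xs

length-filter : ∀ {R : A → Set} (R? : ∀ x → Dec (R x)) xs → length (filter R? xs) ≡ count (does ∘ R?) xs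
length-filter R? []       = refl
length-filter R? (x ∷ xs) with does (R? x)
... | true  = cong suc (length-filter R? xs)
... | false = length-filter R? xs

count-update : ∀ {P Q : A → Bool} {a} xs → Unique xs → a ∈ xs → (∀ {x} → x ∈ xs → x ≢ a → P x ≡ Q x) →
               count P xs + 𝟙 (Q a) ≡ count Q xs + 𝟙 (P a)
count-update {P = P} {Q = Q} (x ∷ xs) (x∉xs ∷ _) (here refl) P≡Q =
  trans (cong (λ c → 𝟙 (P x) + c + 𝟙 (Q x)) (count-cong xs λ y∈ → P≡Q (there y∈) (λ { refl → All.lookup x∉xs y∈ refl })))
        (xy∙z≈zy∙x (𝟙 (P x)) (count Q xs) (𝟙 (Q x)))
count-update {P = P} {Q = Q} {a = a} (x ∷ xs) (x∉xs ∷ xs!) (there a∈) P≡Q = begin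
  𝟙 (P x) + count P xs + 𝟙 (Q a)   ≡⟨ +-assoc (𝟙 (P x)) _ _ ⟩
  𝟙 (P x) + (count P xs + 𝟙 (Q a)) ≡⟨ cong₂ _+_ (cong 𝟙 (P≡Q (here refl) (λ { refl → All.lookup x∉xs a∈ refl })))
                                                (count-update xs xs! a∈ (P≡Q ∘ there)) ⟩
  𝟙 (Q x) + (count Q xs + 𝟙 (P a)) ≡⟨ +-assoc (𝟙 (Q x)) _ _ ⟨
  𝟙 (Q x) + count Q xs + 𝟙 (P a)   ∎
  where open ≡-Reasoning

count-single : ∀ {P : A → Bool} {a} xs → Unique xs → a ∈ xs → P a ≡ true → (∀ {x} → x ∈ xs → x ≢ a → P x ≡ false) →
               count P xs ≡ 1
count-single {P = P} {a} xs xs! a∈ Pa P-off = begin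
  count P xs                      ≡⟨ +-identityʳ _ ⟨
  count P xs + 0                  ≡⟨ count-update xs xs! a∈ (λ x∈ x≢a → sym (P-off x∈ x≢a)) ⟨
  count (λ _ → false) xs + 𝟙 (P a) ≡⟨ cong₂ _+_ (count-false xs) (cong 𝟙 Pa) ⟩
  1                               ∎
  where open ≡-Reasoning

+-exchange : ∀ p q {c d r s} → c + r ≡ d + s → p + c + (q + r) ≡ q + d + (p + s)
+-exchange p q {c} {d} {r} {s} eq = begin
  p + c + (q + r)   ≡⟨ interchange p c q r ⟩
  p + q + (c + r)   ≡⟨ cong₂ _+_ (+-comm p q) eq ⟩
  q + p + (d + s)   ≡⟨ interchange q p d s ⟩
  q + d + (p + s)   ∎
  where open ≡-Reasoning

count-update₂ : ∀ {P Q : A → Bool} {a b} xs → Unique xs → a ∈ xs → b ∈ xs → a ≢ b →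
                (∀ {x} → x ∈ xs → x ≢ a → x ≢ b → P x ≡ Q x) →
                count P xs + (𝟙 (Q a) + 𝟙 (Q b)) ≡ count Q xs + (𝟙 (P a) + 𝟙 (P b))
count-update₂ (x ∷ xs) (x∉xs ∷ xs!) (here refl) (here refl) a≢b P≡Q = ⊥-elim (a≢b refl)
count-update₂ {P = P} {Q} (x ∷ xs) (x∉xs ∷ xs!) (here refl) (there b∈) a≢b P≡Q =
  +-exchange (𝟙 (P x)) (𝟙 (Q x)) (count-update xs xs! b∈ λ y∈ → P≡Q (there y∈) (λ { refl → All.lookup x∉xs y∈ refl }))
count-update₂ {P = P} {Q} {a} (x ∷ xs) (x∉xs ∷ xs!) (there a∈) (here refl) a≢b P≡Q =
  trans (cong (𝟙 (P x) + count P xs +_) (+-comm (𝟙 (Q a)) (𝟙 (Q x))))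
        (trans (+-exchange (𝟙 (P x)) (𝟙 (Q x)) (count-update xs xs! a∈ λ y∈ y≢a → P≡Q (there y∈) y≢a (λ { refl → All.lookup x∉xs y∈ refl })))
               (cong (𝟙 (Q x) + count Q xs +_) (+-comm (𝟙 (P x)) (𝟙 (P a)))))
count-update₂ {P = P} {Q} {a} {b} (x ∷ xs) (x∉xs ∷ xs!) (there a∈) (there b∈) a≢b P≡Q = begin
  𝟙 (P x) + count P xs + (𝟙 (Q a) + 𝟙 (Q b))    ≡⟨ +-assoc (𝟙 (P x)) _ _ ⟩
  𝟙 (P x) + (count P xs + (𝟙 (Q a) + 𝟙 (Q b)))  ≡⟨ cong₂ _+_ (cong 𝟙 (P≡Q (here refl) (λ { refl → All.lookup x∉xs a∈ refl })
                                                                                    (λ { refl → All.lookup x∉xs b∈ refl })))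
                                                             (count-update₂ xs xs! a∈ b∈ a≢b (P≡Q ∘ there)) ⟩
  𝟙 (Q x) + (count Q xs + (𝟙 (P a) + 𝟙 (P b)))  ≡⟨ +-assoc (𝟙 (Q x)) _ _ ⟨
  𝟙 (Q x) + count Q xs + (𝟙 (P a) + 𝟙 (P b))    ∎
  where open ≡-Reasoning

any-true-or-all-false : ∀ (P : A → Bool) xs → (∃ λ x → x ∈ xs × P x ≡ true) ⊎ (∀ {x} → x ∈ xs → P x ≡ false)
any-true-or-all-false P []       = inj₂ λ ()
any-true-or-all-false P (x ∷ xs) with P x in Px | any-true-or-all-false P xs
... | true  | _                    = inj₁ (x , here refl , Px)
... | false | inj₁ (y , y∈ , Py)   = inj₁ (y , there y∈ , Py)
... | false | inj₂ none            = inj₂ λ { (here refl) → Px ; (there y∈) → none y∈ }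

sum-map-mono : ∀ {f g : A → ℕ} xs → (∀ x → f x ≤ g x) → sum (map f xs) ≤ sum (map g xs)
sum-map-mono []       f≤g = z≤n
sum-map-mono (x ∷ xs) f≤g = +-mono-≤ (f≤g x) (sum-map-mono xs f≤g)

sum-map-mono-< : ∀ {f g : A → ℕ} {a} xs → (∀ x → f x ≤ g x) → a ∈ xs → f a < g a →
                 sum (map f xs) < sum (map g xs)
sum-map-mono-< (x ∷ xs) f≤g (here refl) fa<ga = +-mono-<-≤ fa<ga (sum-map-mono xs f≤g)
sum-map-mono-< (x ∷ xs) f≤g (there a∈)  fa<ga = +-mono-≤-< (f≤g x) (sum-map-mono-< xs f≤g a∈ fa<ga)

sum-map-+ : ∀ (f g : A → ℕ) xs → sum (map (λ x → f x + g x) xs) ≡ sum (map f xs) + sum (map g xs)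
sum-map-+ f g []       = refl
sum-map-+ f g (x ∷ xs) = trans (cong (f x + g x +_) (sum-map-+ f g xs)) (interchange (f x) (g x) _ _)

sum-map-const : ∀ n (xs : List A) → sum (map (λ _ → n) xs) ≡ length xs * n
sum-map-const n []       = refl
sum-map-const n (x ∷ xs) = cong (n +_) (sum-map-const n xs)

sum-map-𝟙 : ∀ (P : A → Bool) xs → sum (map (𝟙 ∘ P) xs) ≡ count P xs
sum-map-𝟙 P []       = refl
sum-map-𝟙 P (x ∷ xs) = cong (𝟙 (P x) +_) (sum-map-𝟙 P xs)

sum-count-fibres : ∀ {m} (f : A → Fin m) xs →
                   sum (map (λ κ → count (λ x → does (f x Fin.≟ κ)) xs) (allFin m)) ≡ length xs
sum-count-fibres {m = m} f []       = trans (sum-map-const 0 (allFin m)) (*-zeroʳ (length (allFin m)))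
sum-count-fibres {m = m} f (x ∷ xs) = begin
  sum (map (λ κ → 𝟙 (does (f x Fin.≟ κ)) + count (λ y → does (f y Fin.≟ κ)) xs) (allFin m))
    ≡⟨ sum-map-+ (λ κ → 𝟙 (does (f x Fin.≟ κ))) _ (allFin m) ⟩
  sum (map (λ κ → 𝟙 (does (f x Fin.≟ κ))) (allFin m)) + sum (map (λ κ → count (λ y → does (f y Fin.≟ κ)) xs) (allFin m))
    ≡⟨ cong₂ _+_ (trans (sum-map-𝟙 _ (allFin m))
                        (count-single (allFin m) (Unique.allFin⁺ m) (∈-allFin (f x)) (dec-true (f x Fin.≟ f x) refl)
                                      λ {κ} _ κ≢fx → dec-false (f x Fin.≟ κ) (κ≢fx ∘ sym)))
                 (sum-count-fibres f xs) ⟩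
  suc (length xs)
    ∎
  where open ≡-Reasoning

descent : (Φ : A → ℕ) → (∀ a → B ⊎ Σ A (λ a′ → Φ a′ < Φ a)) → A → B
descent {A = A} {B = B} Φ step a = go a (<-wellFounded (Φ a))
  where
  go : ∀ a → Acc _<_ (Φ a) → B
  go a (acc rs) with step a
  ... | inj₁ b         = b
  ... | inj₂ (a′ , lt) = go a′ (rs lt)

record FiniteGraph : Set₁ where
  field
    Vertex      : Set
    _≟_         : DecidableEquality Vertex
    vertices    : List Vertex
    ∈-vertices  : ∀ u → u ∈ vertices
    nbrs        : Vertex → List Vertex
    nbrs-unique : ∀ u → Unique (nbrs u)
    nbrs-sym    : ∀ {u w} → w ∈ nbrs u → u ∈ nbrs w

  _==_ : Vertex → Vertex → Bool
  u == w = does (u ≟ w)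

  deg : Vertex → ℕ
  deg u = length (nbrs u)

  ∀-or-counterexample : {P : Vertex → Set} → (∀ u → Dec (P u)) → (∀ u → P u) ⊎ ∃ (¬_ ∘ P)
  ∀-or-counterexample P? with All.all? P? vertices
  ... | yes all = inj₁ (λ u → All.lookup all (∈-vertices u))
  ... | no ¬all = inj₂ (satisfied (¬All⇒Any¬ P? vertices ¬all))

  -- O u w ≡ true says that the edge uw points from u to w; values on non-edges are irrelevant.
  Orientation : Set
  Orientation = Vertex → Vertex → Bool

  IsOrientation : Orientation → Set
  IsOrientation O = ∀ {u w} → w ∈ nbrs u → O w u ≡ not (O u w)

  outdeg indeg : Orientation → Vertex → ℕ
  outdeg O u = count (O u) (nbrs u)
  indeg  O u = count (not ∘ O u) (nbrs u)

  IsBalanced : Orientation → Set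
  IsBalanced O = ∀ u → outdeg O u ≤ suc (indeg O u) × indeg O u ≤ suc (outdeg O u)

  imbalance : Orientation → ℕ
  imbalance O = sum (map (λ u → ∣ outdeg O u - indeg O u ∣) vertices)

  IsBipartition : (Vertex → Bool) → Set
  IsBipartition side = ∀ {u w} → w ∈ nbrs u → side w ≡ not (side u)

  IsEdgeColouring : {C : Set} → (Vertex → Vertex → C) → Set
  IsEdgeColouring c = ∀ {u w} → w ∈ nbrs u → c w u ≡ c u w

  colourDeg : ∀ {k} → (Vertex → Vertex → Fin k) → Fin k → Vertex → ℕ
  colourDeg c κ u = count (λ w → does (c u w Fin.≟ κ)) (nbrs u)

-- Balanced orientations

∣m-1+n∣<∣1+m-n∣ : ∀ {m n} → suc n ≤ m → ∣ m - suc n ∣ < ∣ suc m - n ∣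
∣m-1+n∣<∣1+m-n∣ {suc m} {zero}  _         = subst (_< suc (suc m)) (sym (∣-∣-identityʳ m)) (m<n+m m {2} (s≤s z≤n))
∣m-1+n∣<∣1+m-n∣ {suc m} {suc n} (s≤s n<m) = ∣m-1+n∣<∣1+m-n∣ n<m

∣1+m-n∣≤∣m-1+n∣ : ∀ {m n} → m ≤ n → ∣ suc m - n ∣ ≤ ∣ m - suc n ∣
∣1+m-n∣≤∣m-1+n∣ {zero}  {zero}  _         = ≤-refl
∣1+m-n∣≤∣m-1+n∣ {zero}  {suc n} _         = ≤-trans (n≤1+n n) (n≤1+n (suc n))
∣1+m-n∣≤∣m-1+n∣ {suc m} {suc n} (s≤s m≤n) = ∣1+m-n∣≤∣m-1+n∣ m≤n

source-vertex : ∀ {o i o′ i′ b} → o′ + suc b ≡ o + b → i′ + b ≡ i + suc b → 2 + i ≤ o → ∣ o′ - i′ ∣ < ∣ o - i ∣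
source-vertex {o} {i} {o′} {i′} {b} out-eq in-eq excess
  with +-cancelʳ-≡ b (suc o′) o (trans (sym (+-suc o′ b)) out-eq) | +-cancelʳ-≡ b i′ (suc i) (trans in-eq (+-suc i b))
... | refl | refl = ∣m-1+n∣<∣1+m-n∣ (≤-pred excess)

sink-vertex : ∀ {o i o′ i′ a} → o′ + a ≡ o + suc a → i′ + suc a ≡ i + a → o < i → ∣ o′ - i′ ∣ ≤ ∣ o - i ∣
sink-vertex {o} {i} {o′} {i′} {a} out-eq in-eq deficit
  with +-cancelʳ-≡ a o′ (suc o) (trans out-eq (+-suc o a)) | +-cancelʳ-≡ a (suc i′) i (trans (sym (+-suc i′ a)) in-eq)
... | refl | refl = ∣1+m-n∣≤∣m-1+n∣ (≤-pred deficit)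

transit-vertex : ∀ {o i o′ i′ a} → o′ + a ≡ o + a → i′ + a ≡ i + a → ∣ o′ - i′ ∣ ≡ ∣ o - i ∣
transit-vertex {a = a} out-eq in-eq = cong₂ ∣_-_∣ (+-cancelʳ-≡ a _ _ out-eq) (+-cancelʳ-≡ a _ _ in-eq)

module Balancing (G : FiniteGraph) where
  open FiniteGraph G

  module TrailReversal (O : Orientation) (O-orient : IsOrientation O)
                       (v : Vertex) (v-excess : 2 + indeg O v ≤ outdeg O v) where

    usedOut usedIn : (Vertex → Vertex → Bool) → Vertex → ℕ
    usedOut E u = count (λ w → E u w ∧ O u w) (nbrs u)
    usedIn  E u = count (λ w → E u w ∧ not (O u w)) (nbrs u)

    -- A trail from v to end along O, recorded by its edge set: flow is conserved except at its ends.
    record Trail : Set where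
      field
        edges        : Vertex → Vertex → Bool
        end          : Vertex
        edges-sym    : ∀ a b → edges a b ≡ edges b a
        conservation : ∀ u → usedOut edges u + 𝟙 (u == end) ≡ usedIn edges u + 𝟙 (u == v)
    open Trail

    unused : Trail → ℕ
    unused t = sum (map (λ u → count (not ∘ edges t u) (nbrs u)) vertices)

    emptyTrail : Trail
    emptyTrail = record
      { edges        = λ _ _ → false
      ; end          = v
      ; edges-sym    = λ _ _ → refl
      ; conservation = λ u → cong (_+ 𝟙 (u == v)) (trans (count-false (nbrs u)) (sym (count-false (nbrs u))))
      }

    module Extension (t : Trail) {y : Vertex} (y∈ : y ∈ nbrs (end t))
                     (fresh : edges t (end t) y ≡ false) (forward : O (end t) y ≡ true) where

      x : Vertex
      x = end t

      x≢y : x ≢ y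
      x≢y refl = not-fixed (O-orient y∈)
        where
        not-fixed : ∀ {b} → b ≢ not b
        not-fixed {true}  ()
        not-fixed {false} ()

      isXY : Vertex → Vertex → Bool
      isXY a b = (a == x ∧ b == y) ∨ (a == y ∧ b == x)

      edges′ : Vertex → Vertex → Bool
      edges′ a b = isXY a b ∨ edges t a b

      edges′-sym : ∀ a b → edges′ a b ≡ edges′ b a
      edges′-sym a b = cong₂ _∨_ (trans (∨-comm (a == x ∧ b == y) (a == y ∧ b == x)) (cong₂ _∨_ (∧-comm (a == y) (b == x)) (∧-comm (a == x) (b == y))))
                                 (edges-sym t a b)

      edges′-xy : edges′ x y ≡ true
      edges′-xy rewrite dec-true (x ≟ x) refl | dec-true (y ≟ y) refl = refl

      edges′-other : ∀ {a b} → ¬ (a ≡ x × b ≡ y) → ¬ (a ≡ y × b ≡ x) → edges′ a b ≡ edges t a b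
      edges′-other ¬xy ¬yx = cong (_∨ _) (cong₂ _∨_ (pair-false ¬xy) (pair-false ¬yx))
        where
        pair-false : ∀ {a b c d} → ¬ (a ≡ c × b ≡ d) → (a == c ∧ b == d) ≡ false
        pair-false {a} {b} {c} {d} ¬ac×bd with a ≟ c | b ≟ d
        ... | yes a≡c | yes b≡d = ⊥-elim (¬ac×bd (a≡c , b≡d))
        ... | yes _   | no _    = refl
        ... | no _    | _       = refl

      edges′-yx : edges′ y x ≡ true
      edges′-yx = trans (edges′-sym y x) edges′-xy

      count-extended-at : ∀ (F : Vertex → Vertex → Bool) {a b} → b ∈ nbrs a → edges t a b ≡ false → edges′ a b ≡ true →
                 (∀ {w} → w ≢ b → edges′ a w ≡ edges t a w) →
                 count (λ w → edges′ a w ∧ F a w) (nbrs a) ≡ count (λ w → edges t a w ∧ F a w) (nbrs a) + 𝟙 (F a b)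
      count-extended-at F {a} {b} b∈ old new off = begin
        count Q (nbrs a)                 ≡⟨ +-identityʳ _ ⟨
        count Q (nbrs a) + 0             ≡⟨ cong (λ e → count Q (nbrs a) + 𝟙 (e ∧ F a b)) old ⟨
        count Q (nbrs a) + 𝟙 (P b)       ≡⟨ count-update (nbrs a) (nbrs-unique a) b∈ (λ _ w≢b → cong (_∧ F a _) (sym (off w≢b))) ⟨
        count P (nbrs a) + 𝟙 (Q b)       ≡⟨ cong (λ e → count P (nbrs a) + 𝟙 (e ∧ F a b)) new ⟩
        count P (nbrs a) + 𝟙 (F a b)     ∎
        where
        open ≡-Reasoning
        P Q : Vertex → Bool
        P w = edges t a w ∧ F a w
        Q w = edges′ a w ∧ F a w

      count-extended : ∀ (F : Vertex → Vertex → Bool) u →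
                    count (λ w → edges′ u w ∧ F u w) (nbrs u) ≡
                    count (λ w → edges t u w ∧ F u w) (nbrs u) + (𝟙 (u == x ∧ F x y) + 𝟙 (u == y ∧ F y x))
      count-extended F u = by-cases u (u ≟ x) (u ≟ y)
        where
        by-cases : ∀ u (u≟x : Dec (u ≡ x)) (u≟y : Dec (u ≡ y)) →
                   count (λ w → edges′ u w ∧ F u w) (nbrs u) ≡
                   count (λ w → edges t u w ∧ F u w) (nbrs u) + (𝟙 (does u≟x ∧ F x y) + 𝟙 (does u≟y ∧ F y x))
        by-cases _ (yes refl) (yes x≡y) = ⊥-elim (x≢y x≡y)
        by-cases _ (yes refl) (no _)    =
          trans (count-extended-at F y∈ fresh edges′-xy λ w≢y → edges′-other (w≢y ∘ proj₂) (x≢y ∘ proj₁))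
                (cong (count (λ w → edges t x w ∧ F x w) (nbrs x) +_) (sym (+-identityʳ (𝟙 (F x y)))))
        by-cases _ (no _)     (yes refl) =
          count-extended-at F (nbrs-sym y∈) (trans (edges-sym t y x) fresh) edges′-yx
            λ w≢x → edges′-other (x≢y ∘ sym ∘ proj₁) (w≢x ∘ proj₂)
        by-cases u (no u≢x)   (no u≢y)  =
          trans (count-cong (nbrs u) λ {w} _ → cong (_∧ F u w) (edges′-other (u≢x ∘ proj₁) (u≢y ∘ proj₁)))
                (sym (+-identityʳ _))

      backward : O y x ≡ false
      backward = trans (O-orient y∈) (cong not forward)

      usedOut-extended : ∀ u → usedOut edges′ u ≡ usedOut (edges t) u + 𝟙 (u == x)
      usedOut-extended u = begin
        usedOut edges′ u                                              ≡⟨ count-extended O u ⟩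
        usedOut (edges t) u + (𝟙 (u == x ∧ O x y) + 𝟙 (u == y ∧ O y x)) ≡⟨ cong₂ (λ p q → usedOut (edges t) u + (𝟙 (u == x ∧ p) + 𝟙 (u == y ∧ q))) forward backward ⟩
        usedOut (edges t) u + (𝟙 (u == x ∧ true) + 𝟙 (u == y ∧ false)) ≡⟨ cong₂ (λ p q → usedOut (edges t) u + (𝟙 p + 𝟙 q)) (∧-identityʳ _) (∧-zeroʳ _) ⟩
        usedOut (edges t) u + (𝟙 (u == x) + 0)                          ≡⟨ cong (usedOut (edges t) u +_) (+-identityʳ _) ⟩
        usedOut (edges t) u + 𝟙 (u == x)                                ∎
        where open ≡-Reasoning

      usedIn-extended : ∀ u → usedIn edges′ u ≡ usedIn (edges t) u + 𝟙 (u == y)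
      usedIn-extended u = begin
        usedIn edges′ u                                                          ≡⟨ count-extended (λ a b → not (O a b)) u ⟩
        usedIn (edges t) u + (𝟙 (u == x ∧ not (O x y)) + 𝟙 (u == y ∧ not (O y x))) ≡⟨ cong₂ (λ p q → usedIn (edges t) u + (𝟙 (u == x ∧ not p) + 𝟙 (u == y ∧ not q))) forward backward ⟩
        usedIn (edges t) u + (𝟙 (u == x ∧ false) + 𝟙 (u == y ∧ true))             ≡⟨ cong₂ (λ p q → usedIn (edges t) u + (𝟙 p + 𝟙 q)) (∧-zeroʳ _) (∧-identityʳ _) ⟩
        usedIn (edges t) u + 𝟙 (u == y)                                           ∎
        where open ≡-Reasoning

      extended : Trail
      extended = record
        { edges        = edges′
        ; end          = y
        ; edges-sym    = edges′-sym
        ; conservation = λ u → begin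
            usedOut edges′ u + 𝟙 (u == y)                    ≡⟨ cong (_+ 𝟙 (u == y)) (usedOut-extended u) ⟩
            usedOut (edges t) u + 𝟙 (u == x) + 𝟙 (u == y)    ≡⟨ cong (_+ 𝟙 (u == y)) (conservation t u) ⟩
            usedIn (edges t) u + 𝟙 (u == v) + 𝟙 (u == y)     ≡⟨ xy∙z≈xz∙y (usedIn (edges t) u) _ _ ⟩
            usedIn (edges t) u + 𝟙 (u == y) + 𝟙 (u == v)     ≡⟨ cong (_+ 𝟙 (u == v)) (usedIn-extended u) ⟨
            usedIn edges′ u + 𝟙 (u == v)                     ∎
        }
        where open ≡-Reasoning

      unused-extended : unused extended < unused t
      unused-extended = sum-map-mono-< vertices
        (λ u → count-mono (nbrs u) λ {w} _ → not-∨-true⁻ (isXY u w))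
        (∈-vertices x) (≤-reflexive fewer-at-x)
        where
        not-∨-true⁻ : ∀ a {b} → not (a ∨ b) ≡ true → not b ≡ true
        not-∨-true⁻ false h = h

        fewer-at-x : suc (count (not ∘ edges′ x) (nbrs x)) ≡ count (not ∘ edges t x) (nbrs x)
        fewer-at-x = begin
          suc (count (not ∘ edges′ x) (nbrs x))                 ≡⟨ +-comm 1 _ ⟩
          count (not ∘ edges′ x) (nbrs x) + 𝟙 (not false)       ≡⟨ cong (λ b → count (not ∘ edges′ x) (nbrs x) + 𝟙 (not b)) fresh ⟨
          count (not ∘ edges′ x) (nbrs x) + 𝟙 (not (edges t x y))
            ≡⟨ count-update (nbrs x) (nbrs-unique x) y∈ (λ _ w≢y → cong not (edges′-other (w≢y ∘ proj₂) (x≢y ∘ proj₁))) ⟩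
          count (not ∘ edges t x) (nbrs x) + 𝟙 (not (edges′ x y)) ≡⟨ cong (λ b → count (not ∘ edges t x) (nbrs x) + 𝟙 (not b)) edges′-xy ⟩
          count (not ∘ edges t x) (nbrs x) + 0                  ≡⟨ +-identityʳ _ ⟩
          count (not ∘ edges t x) (nbrs x)                      ∎
          where open ≡-Reasoning

    -- No unused out-edge leaves the end: reversing the trail helps at v and does not hurt at the end.
    module Reversal (t : Trail)
                    (stuck : ∀ {w} → w ∈ nbrs (end t) → not (edges t (end t) w) ∧ O (end t) w ≡ false) where

      x : Vertex
      x = end t

      E : Vertex → Vertex → Bool
      E = edges t

      R : Orientation
      R u w = E u w xor O u w

      R-orient : IsOrientation R
      R-orient {u} {w} w∈ = trans (cong₂ _xor_ (edges-sym t w u) (O-orient w∈)) (sym (not-distribʳ-xor (E u w) (O u w)))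

      reversal-count : ∀ (P : Bool → Bool) u →
        count (λ w → P (R u w)) (nbrs u) + count (λ w → E u w ∧ P (O u w)) (nbrs u) ≡
        count (λ w → P (O u w)) (nbrs u) + count (λ w → E u w ∧ P (not (O u w))) (nbrs u)
      reversal-count P u = begin
        count (P ∘ R u) ns + fwd                                                          ≡⟨ cong (_+ fwd) (count-split (P ∘ R u) (E u) ns) ⟩
        count (λ w → E u w ∧ P (R u w)) ns + count (λ w → not (E u w) ∧ P (R u w)) ns + fwd
          ≡⟨ cong (_+ fwd) (cong₂ _+_ (count-cong ns λ {w} _ → on-trail (E u w) (O u w)) (count-cong ns λ {w} _ → off-trail (E u w) (O u w))) ⟩
        bwd + off + fwd                                                                   ≡⟨ xy∙z≈zy∙x bwd off fwd ⟩
        fwd + off + bwd                                                                   ≡⟨ cong (_+ bwd) (count-split (P ∘ O u) (E u) ns) ⟨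
        count (P ∘ O u) ns + bwd                                                          ∎
        where
        open ≡-Reasoning
        ns : List Vertex
        ns = nbrs u
        fwd bwd off : ℕ
        fwd = count (λ w → E u w ∧ P (O u w)) ns
        bwd = count (λ w → E u w ∧ P (not (O u w))) ns
        off = count (λ w → not (E u w) ∧ P (O u w)) ns
        on-trail : ∀ e o → e ∧ P (e xor o) ≡ e ∧ P (not o)
        on-trail true  o = refl
        on-trail false o = refl
        off-trail : ∀ e o → not e ∧ P (e xor o) ≡ not e ∧ P o
        off-trail true  o = refl
        off-trail false o = refl

      outdeg-reversed : ∀ u → outdeg R u + usedOut E u ≡ outdeg O u + usedIn E u
      outdeg-reversed = reversal-count (λ b → b)

      indeg-reversed : ∀ u → indeg R u + usedIn E u ≡ indeg O u + usedOut E u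
      indeg-reversed u = trans (reversal-count not u)
        (cong (indeg O u +_) (count-cong (nbrs u) λ {w} _ → cong (E u w ∧_) (not-involutive (O u w))))

      conservation-at : ∀ u {p q} → (u == x) ≡ p → (u == v) ≡ q → usedOut E u + 𝟙 p ≡ usedIn E u + 𝟙 q
      conservation-at u refl refl = conservation t u

      outdeg-at-end : outdeg O x ≡ usedOut E x
      outdeg-at-end = begin
        outdeg O x                                                        ≡⟨ count-split (O x) (E x) (nbrs x) ⟩
        usedOut E x + count (λ w → not (E x w) ∧ O x w) (nbrs x)          ≡⟨ cong (usedOut E x +_) (trans (count-cong (nbrs x) stuck) (count-false (nbrs x))) ⟩
        usedOut E x + 0                                                   ≡⟨ +-identityʳ _ ⟩
        usedOut E x                                                       ∎
        where open ≡-Reasoning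

      usedIn≤indeg : ∀ u → usedIn E u ≤ indeg O u
      usedIn≤indeg u = count-mono (nbrs u) λ _ → proj₂ ∘ ∧-true⁻

      end≢start : x ≢ v
      end≢start x≡v = <⇒≱ (≤-trans (n≤1+n _) v-excess) (subst (λ z → outdeg O z ≤ indeg O z) x≡v out≤in)
        where
        out≤in : outdeg O x ≤ indeg O x
        out≤in = ≤-trans (≤-reflexive (trans outdeg-at-end
                           (+-cancelʳ-≡ 1 _ _ (conservation-at x (dec-true (x ≟ x) refl) (dec-true (x ≟ v) x≡v)))))
                         (usedIn≤indeg x)

      at-source : ∣ outdeg R v - indeg R v ∣ < ∣ outdeg O v - indeg O v ∣
      at-source = source-vertex (subst (λ a → outdeg R v + a ≡ outdeg O v + usedIn E v) excess (outdeg-reversed v))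
                                (subst (λ a → indeg R v + usedIn E v ≡ indeg O v + a) excess (indeg-reversed v))
                                v-excess
        where
        excess : usedOut E v ≡ suc (usedIn E v)
        excess = trans (sym (+-identityʳ _))
                   (trans (conservation-at v (dec-false (v ≟ x) (end≢start ∘ sym)) (dec-true (v ≟ v) refl)) (+-comm _ 1))

      at-end : ∣ outdeg R x - indeg R x ∣ ≤ ∣ outdeg O x - indeg O x ∣
      at-end = sink-vertex (subst (λ b → outdeg R x + usedOut E x ≡ outdeg O x + b) deficit (outdeg-reversed x))
                           (subst (λ b → indeg R x + b ≡ indeg O x + usedOut E x) deficit (indeg-reversed x))
                           (≤-trans (s≤s (≤-reflexive outdeg-at-end)) (≤-trans (≤-reflexive (sym deficit)) (usedIn≤indeg x)))
        where
        deficit : usedIn E x ≡ suc (usedOut E x)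
        deficit = trans (sym (+-identityʳ _))
                    (trans (sym (conservation-at x (dec-true (x ≟ x) refl) (dec-false (x ≟ v) end≢start))) (+-comm _ 1))

      elsewhere : ∀ {u} → u ≢ v → u ≢ x → ∣ outdeg R u - indeg R u ∣ ≡ ∣ outdeg O u - indeg O u ∣
      elsewhere {u} u≢v u≢x = transit-vertex {a = usedOut E u} (subst (λ b → outdeg R u + usedOut E u ≡ outdeg O u + b) transit (outdeg-reversed u))
                                             (subst (λ b → indeg R u + b ≡ indeg O u + usedOut E u) transit (indeg-reversed u))
        where
        transit : usedIn E u ≡ usedOut E u
        transit = sym (+-cancelʳ-≡ 0 _ _ (conservation-at u (dec-false (u ≟ x) u≢x) (dec-false (u ≟ v) u≢v)))

      reversed : Σ Orientation λ O′ → IsOrientation O′ × imbalance O′ < imbalance O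
      reversed = R , R-orient , sum-map-mono-< vertices reduced (∈-vertices v) at-source
        where
        reduced : ∀ u → ∣ outdeg R u - indeg R u ∣ ≤ ∣ outdeg O u - indeg O u ∣
        reduced u with u ≟ v | u ≟ x
        ... | yes refl | _        = <⇒≤ at-source
        ... | no _     | yes refl = at-end
        ... | no u≢v   | no u≢x   = ≤-reflexive (elsewhere u≢v u≢x)

    improvement : Σ Orientation λ O′ → IsOrientation O′ × imbalance O′ < imbalance O
    improvement = descent unused step emptyTrail
      where
      step : ∀ t → (Σ Orientation λ O′ → IsOrientation O′ × imbalance O′ < imbalance O) ⊎ Σ Trail (λ t′ → unused t′ < unused t)
      step t with any-true-or-all-false (λ w → not (edges t (end t) w) ∧ O (end t) w) (nbrs (end t))
      ... | inj₂ stuck                 = inj₁ (Reversal.reversed t stuck)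
      ... | inj₁ (y , y∈ , untravelled) =
        let fresh , forward = ∧-true⁻ untravelled
            open Extension t y∈ (not-true⁻ fresh) forward
        in inj₂ (extended , unused-extended)

  reverse : Orientation → Orientation
  reverse O u w = not (O u w)

  reverse-orient : ∀ {O} → IsOrientation O → IsOrientation (reverse O)
  reverse-orient O-orient w∈ = cong not (O-orient w∈)

  indeg-reverse : ∀ O u → indeg (reverse O) u ≡ outdeg O u
  indeg-reverse O u = count-cong (nbrs u) λ {w} _ → not-involutive (O u w)

  imbalance-reverse : ∀ O → imbalance (reverse O) ≡ imbalance O
  imbalance-reverse O = cong sum (map-cong (λ u → trans (cong (∣ indeg O u -_∣) (indeg-reverse O u)) (∣-∣-comm (indeg O u) (outdeg O u))) vertices)

  balancedOrientation : ∀ O → IsOrientation O → Σ Orientation λ O′ → IsOrientation O′ × IsBalanced O′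
  balancedOrientation O O-orient = descent (imbalance ∘ proj₁) step (O , O-orient)
    where
    Oriented : Set
    Oriented = Σ Orientation IsOrientation

    step : ∀ ((O , _) : Oriented) → (Σ Orientation λ O′ → IsOrientation O′ × IsBalanced O′) ⊎ Σ Oriented λ (O′ , _) → imbalance O′ < imbalance O
    step (O , O-orient) with ∀-or-counterexample (λ u → outdeg O u ≤? suc (indeg O u) ×-dec indeg O u ≤? suc (outdeg O u))
    ... | inj₁ balanced = inj₁ (O , O-orient , balanced)
    ... | inj₂ (u , unbalanced) with outdeg O u ≤? suc (indeg O u)
    ...   | no out-excess = let O′ , O′-orient , lt = TrailReversal.improvement O O-orient u (≰⇒> out-excess)
                            in inj₂ ((O′ , O′-orient) , lt)
    ...   | yes out≤ = let O′ , O′-orient , lt = TrailReversal.improvement (reverse O) (reverse-orient O-orient) u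
                                                  (subst (λ n → 2 + n ≤ indeg O u) (sym (indeg-reverse O u)) (≰⇒> λ in≤ → unbalanced (out≤ , in≤)))
                       in inj₂ ((O′ , O′-orient) , subst (imbalance O′ <_) (imbalance-reverse O) lt)

module _ (G : FiniteGraph) where
  open FiniteGraph G

  restrict : (P : Vertex → Vertex → Bool) → (∀ {u w} → w ∈ nbrs u → P w u ≡ P u w) → FiniteGraph
  restrict P P-sym = record
    { Vertex      = Vertex
    ; _≟_         = _≟_
    ; vertices    = vertices
    ; ∈-vertices  = ∈-vertices
    ; nbrs        = λ u → filter (T? ∘ P u) (nbrs u)
    ; nbrs-unique = λ u → Unique.filter⁺ (T? ∘ P u) (nbrs-unique u)
    ; nbrs-sym    = λ w∈ → let w∈G , Puw = ∈-filter⁻ (T? ∘ P _) w∈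
                           in ∈-filter⁺ (T? ∘ P _) (nbrs-sym w∈G) (Equivalence.from T-≡ (trans (P-sym w∈G) (Equivalence.to T-≡ Puw)))
    }

  module _ {P : Vertex → Vertex → Bool} (P-sym : ∀ {u w} → w ∈ nbrs u → P w u ≡ P u w) where
    open FiniteGraph (restrict P P-sym) using () renaming (nbrs to nbrsᴾ)

    restrict-nbrs⁺ : ∀ {u w} → w ∈ nbrs u → P u w ≡ true → w ∈ nbrsᴾ u
    restrict-nbrs⁺ w∈ Puw = ∈-filter⁺ (T? ∘ P _) w∈ (Equivalence.from T-≡ Puw)

    restrict-count : ∀ (Q : Vertex → Bool) u → count Q (nbrsᴾ u) ≡ count (λ w → P u w ∧ Q w) (nbrs u)
    restrict-count Q u = count-filter (T? ∘ P u) Q (nbrs u)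

    restrict-deg : ∀ u → length (nbrsᴾ u) ≡ count (P u) (nbrs u)
    restrict-deg u = length-filter (T? ∘ P u) (nbrs u)

  restrict-bipartition : ∀ {P} (P-sym : ∀ {u w} → w ∈ nbrs u → P w u ≡ P u w) {side} →
                         IsBipartition side → FiniteGraph.IsBipartition (restrict P P-sym) side
  restrict-bipartition {P} _ bipartite w∈ = bipartite (proj₁ (∈-filter⁻ (T? ∘ P _) w∈))

module _ (G : FiniteGraph) (side : FiniteGraph.Vertex G → Bool) (bipartite : FiniteGraph.IsBipartition G side) where
  open FiniteGraph G
  open Balancing G

  balancedTwoColouring : Σ (Vertex → Vertex → Bool) λ E → IsEdgeColouring E × IsBalanced E
  balancedTwoColouring with balancedOrientation (λ u _ → side u) bipartite
  ... | O , O-orient , O-balanced = E , E-sym , E-balanced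
    where
    E : Vertex → Vertex → Bool
    E u w = side u xor O u w

    E-sym : IsEdgeColouring E
    E-sym {u} {w} w∈ = trans (cong₂ _xor_ (bipartite w∈) (O-orient w∈)) (not-xor-not (side u) (O u w))
      where
      not-xor-not : ∀ a b → not a xor not b ≡ a xor b
      not-xor-not true  b = refl
      not-xor-not false b = not-involutive b

    E-balanced : IsBalanced E
    E-balanced u with side u | O-balanced u
    ... | false | out≤ , in≤ = out≤ , in≤
    ... | true  | out≤ , in≤ rewrite count-cong (nbrs u) (λ {w} _ → not-involutive (O u w)) = in≤ , out≤

-- Kőnig's edge-colouring theorem

zeros-balanced : ∀ {a b a′ b′} → a + b ≡ a′ + b′ → a′ ≤ suc b′ → b′ ≤ suc a′ →
                 𝟙 (a′ ≡ᵇ 0) + 𝟙 (b′ ≡ᵇ 0) ≤ 𝟙 (a ≡ᵇ 0) + 𝟙 (b ≡ᵇ 0)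
zeros-balanced {zero}        {zero}  {zero}        {zero}        _  _       _       = ≤-refl
zeros-balanced {zero}        {suc _} {zero}        {zero}        () _       _
zeros-balanced {suc _}       {_}     {zero}        {zero}        () _       _
zeros-balanced {zero}        {_}     {zero}        {suc zero}    _  _       _       = s≤s z≤n
zeros-balanced {suc zero}    {zero}  {zero}        {suc zero}    _  _       _       = ≤-refl
zeros-balanced {suc zero}    {suc _} {zero}        {suc zero}    () _       _
zeros-balanced {suc (suc _)} {_}     {zero}        {suc zero}    () _       _
zeros-balanced {_}           {_}     {zero}        {suc (suc _)} _  _       (s≤s ())
zeros-balanced {zero}        {_}     {suc zero}    {zero}        _  _       _       = s≤s z≤n
zeros-balanced {suc zero}    {zero}  {suc zero}    {zero}        _  _       _       = ≤-refl
zeros-balanced {suc zero}    {suc _} {suc zero}    {zero}        () _       _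
zeros-balanced {suc (suc _)} {_}     {suc zero}    {zero}        () _       _
zeros-balanced {_}           {_}     {suc (suc _)} {zero}        _  (s≤s ()) _
zeros-balanced {_}           {_}     {suc _}       {suc _}       _  _       _       = z≤n

zeros-drop : ∀ {a a′ b′} → 2 ≤ a → a + 0 ≡ a′ + b′ → a′ ≤ suc b′ → b′ ≤ suc a′ →
             𝟙 (a′ ≡ᵇ 0) + 𝟙 (b′ ≡ᵇ 0) < 𝟙 (a ≡ᵇ 0) + 𝟙 (0 ≡ᵇ 0)
zeros-drop {suc (suc _)} {suc _}       {suc _}       _ _  _        _        = s≤s z≤n
zeros-drop {suc (suc _)} {zero}        {zero}        _ () _        _
zeros-drop {suc (suc _)} {zero}        {suc zero}    _ () _        _
zeros-drop {suc (suc _)} {zero}        {suc (suc _)} _ _  _        (s≤s ())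
zeros-drop {suc (suc _)} {suc zero}    {zero}        _ () _        _
zeros-drop {suc (suc _)} {suc (suc _)} {zero}        _ _  (s≤s ()) _
zeros-drop {suc zero}    {_}           {_}           (s≤s ()) _ _ _

module König (G : FiniteGraph) (side : FiniteGraph.Vertex G → Bool) (bipartite : FiniteGraph.IsBipartition G side)
             (k : ℕ) (Δ≤ : ∀ u → FiniteGraph.deg G u ≤ suc k) where
  open FiniteGraph G

  Colouring : Set
  Colouring = Vertex → Vertex → Fin (suc k)

  IsProper : Colouring → Set
  IsProper c = ∀ u κ → colourDeg c κ u ≤ 1

  missing : Colouring → Vertex → ℕ
  missing c u = count (λ κ → colourDeg c κ u ≡ᵇ 0) (allFin (suc k))

  totalMissing : Colouring → ℕ
  totalMissing c = sum (map (missing c) vertices)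

  missingColour : ∀ c u {α} → 2 ≤ colourDeg c α u → ∃ λ β → colourDeg c β u ≡ 0
  missingColour c u {α} α-repeated with Fin.any? (λ β → colourDeg c β u ℕ.≟ 0)
  ... | yes found = found
  ... | no  none  = ⊥-elim (<⇒≱ too-many (Δ≤ u))
    where
    open ≤-Reasoning
    too-many : suc k < deg u
    too-many = begin-strict
      suc k                                                  ≡⟨ length-tabulate {n = suc k} (λ κ → κ) ⟨
      length (allFin (suc k))                                ≡⟨ *-identityʳ _ ⟨
      length (allFin (suc k)) ℕ.* 1                          ≡⟨ sum-map-const 1 (allFin (suc k)) ⟨
      sum (map (λ _ → 1) (allFin (suc k)))                   <⟨ sum-map-mono-< (allFin (suc k)) (λ β → n≢0⇒n>0 λ eq → none (β , eq))
                                                                               (∈-allFin α) α-repeated ⟩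
      sum (map (λ κ → colourDeg c κ u) (allFin (suc k)))     ≡⟨ sum-count-fibres (c u) (nbrs u) ⟩
      deg u                                                  ∎

  -- Recolouring the α/β-subgraph by a balanced 2-colouring evens out α and β at every vertex: no vertex
  -- loses a colour, and one with α twice and β missing gains β.
  module Kempe (c : Colouring) (c-col : IsEdgeColouring c) {α β : Fin (suc k)} (α≢β : α ≢ β) where

    inAB : Vertex → Vertex → Bool
    inAB u w = does (c u w Fin.≟ α) ∨ does (c u w Fin.≟ β)

    inAB-sym : ∀ {u w} → w ∈ nbrs u → inAB w u ≡ inAB u w
    inAB-sym w∈ = cong (λ κ → does (κ Fin.≟ α) ∨ does (κ Fin.≟ β)) (c-col w∈)

    H : FiniteGraph
    H = restrict G inAB inAB-sym

    two-colouring : Σ (Vertex → Vertex → Bool) λ E → FiniteGraph.IsEdgeColouring H E × FiniteGraph.IsBalanced H E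
    two-colouring = balancedTwoColouring H side (restrict-bipartition G inAB-sym bipartite)

    E : Vertex → Vertex → Bool
    E = proj₁ two-colouring

    recolour : Bool → Bool → Fin (suc k) → Fin (suc k)
    recolour true  true  _ = α
    recolour true  false _ = β
    recolour false _     κ = κ

    c′ : Colouring
    c′ u w = recolour (inAB u w) (E u w) (c u w)

    c′-col : IsEdgeColouring c′
    c′-col {u} {w} w∈ = trans (cong₂ (λ a κ → recolour a (E w u) κ) (inAB-sym w∈) (c-col w∈))
                              (recolour-cong (inAB u w) λ inH → proj₁ (proj₂ two-colouring) (restrict-nbrs⁺ G inAB-sym w∈ inH))
      where
      recolour-cong : ∀ a {e e′ κ} → (a ≡ true → e ≡ e′) → recolour a e κ ≡ recolour a e′ κ
      recolour-cong true  e≡e′ = cong (λ e → recolour true e _) (e≡e′ refl)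
      recolour-cong false _    = refl

    recolour-α : ∀ a e κ → (a ≡ false → does (κ Fin.≟ α) ≡ false) → does (recolour a e κ Fin.≟ α) ≡ a ∧ e
    recolour-α true  true  _ _ = dec-true (α Fin.≟ α) refl
    recolour-α true  false _ _ = dec-false (β Fin.≟ α) (α≢β ∘ sym)
    recolour-α false _     _ h = h refl

    recolour-β : ∀ a e κ → (a ≡ false → does (κ Fin.≟ β) ≡ false) → does (recolour a e κ Fin.≟ β) ≡ a ∧ not e
    recolour-β true  true  _ _ = dec-false (α Fin.≟ β) α≢β
    recolour-β true  false _ _ = dec-true (β Fin.≟ β) refl
    recolour-β false _     _ h = h refl

    recolour-other : ∀ {γ} → γ ≢ α → γ ≢ β → ∀ a e κ → (a ≡ true → does (κ Fin.≟ γ) ≡ false) →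
                     does (recolour a e κ Fin.≟ γ) ≡ does (κ Fin.≟ γ)
    recolour-other γ≢α γ≢β true  true  _ h = trans (dec-false (α Fin.≟ _) (γ≢α ∘ sym)) (sym (h refl))
    recolour-other γ≢α γ≢β true  false _ h = trans (dec-false (β Fin.≟ _) (γ≢β ∘ sym)) (sym (h refl))
    recolour-other γ≢α γ≢β false _     _ h = refl

    inAB-other : ∀ {γ} → γ ≢ α → γ ≢ β → ∀ u w → inAB u w ≡ true → does (c u w Fin.≟ γ) ≡ false
    inAB-other {γ} γ≢α γ≢β u w with c u w Fin.≟ α | c u w Fin.≟ β
    ... | yes cuw≡α | _         = λ _ → dec-false (c u w Fin.≟ γ) λ cuw≡γ → γ≢α (trans (sym cuw≡γ) cuw≡α)
    ... | no _      | yes cuw≡β = λ _ → dec-false (c u w Fin.≟ γ) λ cuw≡γ → γ≢β (trans (sym cuw≡γ) cuw≡β)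
    ... | no _      | no _      = λ ()

    colourDeg-α : ∀ u → colourDeg c′ α u ≡ count (E u) (FiniteGraph.nbrs H u)
    colourDeg-α u = trans (count-cong (nbrs u) λ {w} _ → recolour-α (inAB u w) (E u w) (c u w) (proj₁ ∘ ∨-false⁻))
                          (sym (restrict-count G inAB-sym (E u) u))

    colourDeg-β : ∀ u → colourDeg c′ β u ≡ count (not ∘ E u) (FiniteGraph.nbrs H u)
    colourDeg-β u = trans (count-cong (nbrs u) λ {w} _ → recolour-β (inAB u w) (E u w) (c u w) (proj₂ ∘ ∨-false⁻))
                          (sym (restrict-count G inAB-sym (not ∘ E u) u))

    colourDeg-other : ∀ {γ} → γ ≢ α → γ ≢ β → ∀ u → colourDeg c′ γ u ≡ colourDeg c γ u
    colourDeg-other γ≢α γ≢β u = count-cong (nbrs u) λ {w} _ →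
      recolour-other γ≢α γ≢β (inAB u w) (E u w) (c u w) (inAB-other γ≢α γ≢β u w)

    deg-H : ∀ u → FiniteGraph.deg H u ≡ colourDeg c α u + colourDeg c β u
    deg-H u = trans (restrict-deg G inAB-sym u)
      (trans (count-split (inAB u) (λ w → does (c u w Fin.≟ α)) (nbrs u))
             (cong₂ _+_ (count-cong (nbrs u) λ {w} _ → ∧-abs-∨ (does (c u w Fin.≟ α)) (does (c u w Fin.≟ β)))
                        (count-cong (nbrs u) λ {w} _ → only-β (c u w))))
      where
      only-β : ∀ κ → not (does (κ Fin.≟ α)) ∧ (does (κ Fin.≟ α) ∨ does (κ Fin.≟ β)) ≡ does (κ Fin.≟ β)
      only-β κ with κ Fin.≟ α
      ... | yes κ≡α = sym (dec-false (κ Fin.≟ β) λ κ≡β → α≢β (trans (sym κ≡α) κ≡β))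
      ... | no _    = refl

    pair-preserved : ∀ u → colourDeg c α u + colourDeg c β u ≡ colourDeg c′ α u + colourDeg c′ β u
    pair-preserved u = trans (sym (deg-H u))
      (trans (sym (count-complement (E u) (FiniteGraph.nbrs H u))) (sym (cong₂ _+_ (colourDeg-α u) (colourDeg-β u))))

    pair-balanced : ∀ u → colourDeg c′ α u ≤ suc (colourDeg c′ β u) × colourDeg c′ β u ≤ suc (colourDeg c′ α u)
    pair-balanced u rewrite colourDeg-α u | colourDeg-β u = proj₂ (proj₂ two-colouring) u

    pairZeros : Colouring → Vertex → ℕ
    pairZeros d u = 𝟙 (colourDeg d α u ≡ᵇ 0) + 𝟙 (colourDeg d β u ≡ᵇ 0)

    missing-exchange : ∀ u → missing c′ u + pairZeros c u ≡ missing c u + pairZeros c′ u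
    missing-exchange u = count-update₂ (allFin (suc k)) (Unique.allFin⁺ (suc k)) (∈-allFin α) (∈-allFin β) α≢β
      λ _ γ≢α γ≢β → cong (_≡ᵇ 0) (colourDeg-other γ≢α γ≢β u)

    missing-mono : ∀ u → missing c′ u ≤ missing c u
    missing-mono u = +-cancelʳ-≤ (pairZeros c u) _ _ (begin
      missing c′ u + pairZeros c u  ≡⟨ missing-exchange u ⟩
      missing c u + pairZeros c′ u  ≤⟨ +-monoʳ-≤ (missing c u) (zeros-balanced {a = colourDeg c α u} (pair-preserved u)
                                                                 (proj₁ (pair-balanced u)) (proj₂ (pair-balanced u))) ⟩
      missing c u + pairZeros c u   ∎)
      where open ≤-Reasoning

    missing-drop : ∀ u → 2 ≤ colourDeg c α u → colourDeg c β u ≡ 0 → missing c′ u < missing c u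
    missing-drop u α-repeated β-missing = +-cancelʳ-< (pairZeros c u) _ _ (begin-strict
      missing c′ u + pairZeros c u  ≡⟨ missing-exchange u ⟩
      missing c u + pairZeros c′ u  <⟨ +-monoʳ-< (missing c u) new<old ⟩
      missing c u + pairZeros c u   ∎)
      where
      open ≤-Reasoning
      new<old : pairZeros c′ u < pairZeros c u
      new<old rewrite β-missing = zeros-drop α-repeated (subst (λ b → colourDeg c α u + b ≡ colourDeg c′ α u + colourDeg c′ β u) β-missing (pair-preserved u))
                                             (proj₁ (pair-balanced u)) (proj₂ (pair-balanced u))

  properColouring : Σ Colouring λ c → IsEdgeColouring c × IsProper c
  properColouring = descent (totalMissing ∘ proj₁) step ((λ _ _ → zero) , λ _ → refl)
    where
    EdgeColouring : Set
    EdgeColouring = Σ Colouring IsEdgeColouring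

    step : ∀ ((c , _) : EdgeColouring) →
           (Σ Colouring λ c → IsEdgeColouring c × IsProper c) ⊎ Σ EdgeColouring λ (c′ , _) → totalMissing c′ < totalMissing c
    step (c , c-col) with ∀-or-counterexample (λ u → Fin.all? λ κ → colourDeg c κ u ≤? 1)
    ... | inj₁ proper         = inj₁ (c , c-col , proper)
    ... | inj₂ (u , improper) =
      let α , α-repeated = Fin.¬∀⟶∃¬ (suc k) _ (λ κ → colourDeg c κ u ≤? 1) improper
          β , β-missing  = missingColour c u (≰⇒> α-repeated)
          α≢β : α ≢ β
          α≢β = λ α≡β → α-repeated (subst (λ κ → colourDeg c κ u ≤ 1) (sym α≡β) (subst (_≤ 1) (sym β-missing) z≤n))
          open Kempe c c-col α≢β
      in inj₂ ((c′ , c′-col) , sum-map-mono-< vertices missing-mono (∈-vertices u) (missing-drop u (≰⇒> α-repeated) β-missing))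

-- Splitting the vertices of an oriented graph

half-bound : ∀ {m n d} → m + n ≤ d + d → m ≤ suc n → m ≤ d
half-bound {m} {n} {d} m+n≤d+d m≤1+n with m ≤? d
... | yes m≤d = m≤d
... | no  m≰d = ⊥-elim (1+n≰n (begin
  suc (suc (d + d))   ≡⟨ cong suc (+-suc d d) ⟨
  suc d + suc d       ≤⟨ +-mono-≤ (≰⇒> m≰d) (≰⇒> m≰d) ⟩
  m + m               ≤⟨ +-monoʳ-≤ m m≤1+n ⟩
  m + suc n           ≡⟨ +-suc m n ⟩
  suc (m + n)         ≤⟨ s≤s m+n≤d+d ⟩
  suc (d + d)         ∎))
  where open ≤-Reasoning

module _ (G : FiniteGraph) where
  open FiniteGraph G

  module _ (O : Orientation) (O-orient : IsOrientation O) where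

    -- (u , true) carries the out-edges of u and (u , false) its in-edges.
    splitNbrs : Vertex × Bool → List (Vertex × Bool)
    splitNbrs (u , s) = map (_, not s) (filter (λ w → O u w Bool.≟ s) (nbrs u))

    splitNbrs⁺ : ∀ {u w s} → w ∈ nbrs u → O u w ≡ s → (w , not s) ∈ splitNbrs (u , s)
    splitNbrs⁺ {u} {s = s} w∈ Ouw≡s = ∈-map⁺ (_, not s) (∈-filter⁺ (λ w → O u w Bool.≟ s) w∈ Ouw≡s)

    split : FiniteGraph
    split = record
      { Vertex      = Vertex × Bool
      ; _≟_         = ≡-dec _≟_ Bool._≟_
      ; vertices    = cartesianProduct vertices (true ∷ false ∷ [])
      ; ∈-vertices  = λ (u , s) → ∈-cartesianProduct⁺ (∈-vertices u) (∈-Bool s)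
      ; nbrs        = splitNbrs
      ; nbrs-unique = λ (u , s) → Unique.map⁺ (cong proj₁) (Unique.filter⁺ (λ w → O u w Bool.≟ s) (nbrs-unique u))
      ; nbrs-sym    = sym′
      }
      where
      ∈-Bool : ∀ s → s ∈ true ∷ false ∷ []
      ∈-Bool true  = here refl
      ∈-Bool false = there (here refl)

      sym′ : ∀ {b b′} → b′ ∈ splitNbrs b → b ∈ splitNbrs b′
      sym′ {u , s} b′∈ with ∈-map⁻ (_, not s) b′∈
      ... | w , w∈′ , refl = let w∈ , Ouw≡s = ∈-filter⁻ (λ w → O u w Bool.≟ s) w∈′
                             in subst (λ t → (u , t) ∈ splitNbrs (w , not s)) (not-involutive s)
                                      (splitNbrs⁺ (nbrs-sym w∈) (trans (O-orient w∈) (cong not Ouw≡s)))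

    split-bipartite : FiniteGraph.IsBipartition split proj₂
    split-bipartite {u , s} b′∈ with ∈-map⁻ (_, not s) b′∈
    ... | _ , _ , refl = refl

    split-deg-out : ∀ u → FiniteGraph.deg split (u , true) ≡ outdeg O u
    split-deg-out u = begin
      length (map (_, false) (filter (λ w → O u w Bool.≟ true) (nbrs u)))  ≡⟨ length-map (_, false) (filter (λ w → O u w Bool.≟ true) (nbrs u)) ⟩
      length (filter (λ w → O u w Bool.≟ true) (nbrs u))                    ≡⟨ length-filter (λ w → O u w Bool.≟ true) (nbrs u) ⟩
      count (λ w → does (O u w Bool.≟ true)) (nbrs u)                       ≡⟨ count-cong (nbrs u) (λ {w} _ → is-true (O u w)) ⟩
      outdeg O u                                                           ∎
      where
      open ≡-Reasoning
      is-true : ∀ b → does (b Bool.≟ true) ≡ b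
      is-true true  = refl
      is-true false = refl

    split-deg-in : ∀ u → FiniteGraph.deg split (u , false) ≡ indeg O u
    split-deg-in u = begin
      length (map (_, true) (filter (λ w → O u w Bool.≟ false) (nbrs u)))  ≡⟨ length-map (_, true) (filter (λ w → O u w Bool.≟ false) (nbrs u)) ⟩
      length (filter (λ w → O u w Bool.≟ false) (nbrs u))                   ≡⟨ length-filter (λ w → O u w Bool.≟ false) (nbrs u) ⟩
      count (λ w → does (O u w Bool.≟ false)) (nbrs u)                      ≡⟨ count-cong (nbrs u) (λ {w} _ → is-false (O u w)) ⟩
      indeg O u                                                            ∎
      where
      open ≡-Reasoning
      is-false : ∀ b → does (b Bool.≟ false) ≡ not b
      is-false true  = refl
      is-false false = refl

    split-deg≤ : ∀ {d} → IsBalanced O → (∀ u → deg u ≤ d + d) → ∀ b → FiniteGraph.deg split b ≤ d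
    split-deg≤ {d} O-balanced deg≤ (u , true)  =
      subst (_≤ d) (sym (split-deg-out u)) (half-bound out+in (proj₁ (O-balanced u)))
      where
      out+in : outdeg O u + indeg O u ≤ d + d
      out+in = subst (_≤ d + d) (sym (count-complement (O u) (nbrs u))) (deg≤ u)
    split-deg≤ {d} O-balanced deg≤ (u , false) =
      subst (_≤ d) (sym (split-deg-in u)) (half-bound in+out (proj₂ (O-balanced u)))
      where
      in+out : indeg O u + outdeg O u ≤ d + d
      in+out = subst (_≤ d + d) (trans (sym (count-complement (O u) (nbrs u))) (+-comm (outdeg O u) _)) (deg≤ u)

    module _ {m} (c : Vertex × Bool → Vertex × Bool → Fin m) where

      unsplit : Vertex → Vertex → Fin m
      unsplit u w = c (u , O u w) (w , not (O u w))

      unsplit-col : FiniteGraph.IsEdgeColouring split c → IsEdgeColouring unsplit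
      unsplit-col c-col {u} {w} w∈ = begin
        c (w , O w u) (u , not (O w u))                   ≡⟨ cong (λ t → c (w , t) (u , not t)) (O-orient w∈) ⟩
        c (w , not (O u w)) (u , not (not (O u w)))       ≡⟨ cong (λ t → c (w , not (O u w)) (u , t)) (not-involutive (O u w)) ⟩
        c (w , not (O u w)) (u , O u w)                   ≡⟨ c-col (splitNbrs⁺ w∈ refl) ⟩
        c (u , O u w) (w , not (O u w))                   ∎
        where open ≡-Reasoning

      colourDeg-unsplit : ∀ κ u → colourDeg unsplit κ u ≡
                          FiniteGraph.colourDeg split c κ (u , true) + FiniteGraph.colourDeg split c κ (u , false)
      colourDeg-unsplit κ u = begin
        count (λ w → F w (O u w)) (nbrs u)
          ≡⟨ count-split _ (O u) (nbrs u) ⟩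
        count (λ w → O u w ∧ F w (O u w)) (nbrs u) + count (λ w → not (O u w) ∧ F w (O u w)) (nbrs u)
          ≡⟨ cong₂ _+_ (count-cong (nbrs u) λ {w} _ → out-side (F w) (O u w)) (count-cong (nbrs u) λ {w} _ → in-side (F w) (O u w)) ⟩
        count (λ w → does (O u w Bool.≟ true) ∧ F w true) (nbrs u) + count (λ w → does (O u w Bool.≟ false) ∧ F w false) (nbrs u)
          ≡⟨ cong₂ _+_ (side true) (side false) ⟨
        FiniteGraph.colourDeg split c κ (u , true) + FiniteGraph.colourDeg split c κ (u , false)
          ∎
        where
        open ≡-Reasoning

        F : Vertex → Bool → Bool
        F w o = does (c (u , o) (w , not o) Fin.≟ κ)

        out-side : ∀ (P : Bool → Bool) o → o ∧ P o ≡ does (o Bool.≟ true) ∧ P true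
        out-side P true  = refl
        out-side P false = refl

        in-side : ∀ (P : Bool → Bool) o → not o ∧ P o ≡ does (o Bool.≟ false) ∧ P false
        in-side P true  = refl
        in-side P false = refl

        side : ∀ s → FiniteGraph.colourDeg split c κ (u , s) ≡ count (λ w → does (O u w Bool.≟ s) ∧ F w s) (nbrs u)
        side s = trans (count-map (λ b → does (c (u , s) b Fin.≟ κ)) (_, not s) (filter (λ w → O u w Bool.≟ s) (nbrs u))) (count-filter (λ w → O u w Bool.≟ s) (λ w → F w s) (nbrs u))

  module _ (k : ℕ) (O₀ : Orientation) (O₀-orient : IsOrientation O₀) (deg≤ : ∀ u → deg u ≤ suc k + suc k) where
    open Balancing G

    edgeColouringTwoPerVertex : Σ (Vertex → Vertex → Fin (suc k)) λ c → IsEdgeColouring c × (∀ u κ → colourDeg c κ u ≤ 2)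
    edgeColouringTwoPerVertex with balancedOrientation O₀ O₀-orient
    ... | O , O-orient , O-balanced
      with König.properColouring (split O O-orient) proj₂ (split-bipartite O O-orient) k (split-deg≤ O O-orient O-balanced deg≤)
    ...   | c , c-col , c-proper =
      unsplit O O-orient c , unsplit-col O O-orient c c-col ,
      λ u κ → subst (_≤ 2) (sym (colourDeg-unsplit O O-orient c κ u)) (+-mono-≤ (c-proper (u , true) κ) (c-proper (u , false) κ))

module _ {n} (G : SimpleGraph n) where

  ∈-neighbours⁻ : ∀ {u w} → w ∈ neighbours G u → Adj G u w
  ∈-neighbours⁻ {u} w∈ = proj₂ (∈-filter⁻ (adj? G u) {xs = allFin n} w∈)

  ∈-neighbours⁺ : ∀ {u w} → Adj G u w → w ∈ neighbours G u
  ∈-neighbours⁺ {u} {w} uw = ∈-filter⁺ (adj? G u) (∈-allFin w) uw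

  graph : FiniteGraph
  graph = record
    { Vertex      = Fin n
    ; _≟_         = Fin._≟_
    ; vertices    = allFin n
    ; ∈-vertices  = ∈-allFin
    ; nbrs        = neighbours G
    ; nbrs-unique = λ u → Unique.filter⁺ (adj? G u) (Unique.allFin⁺ n)
    ; nbrs-sym    = λ w∈ → ∈-neighbours⁺ (SimpleGraph.sym G (∈-neighbours⁻ w∈))
    }

  open FiniteGraph graph using (Orientation; IsOrientation; IsEdgeColouring; colourDeg)

  indexOrder : Orientation
  indexOrder u w = does (u Fin.<? w)

  indexOrder-orient : IsOrientation indexOrder
  indexOrder-orient {u} {w} w∈ with Fin.<-cmp u w
  ... | tri< u<w _   w≮u = trans (dec-false (w Fin.<? u) w≮u) (cong not (sym (dec-true (u Fin.<? w) u<w)))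
  ... | tri≈ _   u≡w _   = ⊥-elim (irrefl G (subst (Adj G u) (sym u≡w) (∈-neighbours⁻ w∈)))
  ... | tri> u≮w _   w<u = trans (dec-true (w Fin.<? u) w<u) (cong not (sym (dec-false (u Fin.<? w) u≮w)))

  module _ {k} (c : Fin n → Fin n → Fin (suc k)) (c-col : IsEdgeColouring c) where

    -- EdgeColoring colours every pair of vertices symmetrically; non-adjacent pairs get colour zero.
    symmetrise : Fin n → Fin n → Fin (suc k)
    symmetrise u w = if does (adj? G u w) then c u w else zero

    symmetrise-sym : ∀ u w → symmetrise u w ≡ symmetrise w u
    symmetrise-sym u w = by-adjacency (adj? G u w) (adj? G w u)
      where
      by-adjacency : (uw? : Dec (Adj G u w)) (wu? : Dec (Adj G w u)) →
                     (if does uw? then c u w else zero) ≡ (if does wu? then c w u else zero)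
      by-adjacency (yes uw) (yes _)  = sym (c-col (∈-neighbours⁺ uw))
      by-adjacency (yes uw) (no ¬wu) = ⊥-elim (¬wu (SimpleGraph.sym G uw))
      by-adjacency (no ¬uw) (yes wu) = ⊥-elim (¬uw (SimpleGraph.sym G wu))
      by-adjacency (no _)   (no _)   = refl

    edgeColoring : EdgeColoring G (suc k)
    edgeColoring = record { col = symmetrise ; symm = symmetrise-sym }

    colourDeg-symmetrise : ∀ κ u → colourDeg symmetrise κ u ≡ colourDeg c κ u
    colourDeg-symmetrise κ u = count-cong (neighbours G u) λ {w} w∈ →
      cong (λ b → does ((if b then c u w else zero) Fin.≟ κ)) (dec-true (adj? G u w) (∈-neighbours⁻ w∈))

  length-othersAt : ∀ {u v} → Adj G u v → suc (length (othersAt G u v)) ≡ degree G u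
  length-othersAt {u} {v} uv = begin
    suc (length (othersAt G u v))                                            ≡⟨ cong suc (length-filter (λ w → ¬? (w Fin.≟ v)) (neighbours G u)) ⟩
    suc (count (λ w → not (does (w Fin.≟ v))) (neighbours G u))              ≡⟨ cong (_+ count (λ w → not (does (w Fin.≟ v))) (neighbours G u)) single ⟨
    count (λ w → does (w Fin.≟ v)) (neighbours G u) + count (λ w → not (does (w Fin.≟ v))) (neighbours G u)
                                                                             ≡⟨ count-complement (λ w → does (w Fin.≟ v)) (neighbours G u) ⟩
    degree G u                                                               ∎
    where
    open ≡-Reasoning
    single : count (λ w → does (w Fin.≟ v)) (neighbours G u) ≡ 1
    single = count-single (neighbours G u) (FiniteGraph.nbrs-unique graph u) (∈-neighbours⁺ uv) (dec-true (v Fin.≟ v) refl)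
                          (λ _ w≢v → dec-false (_ Fin.≟ v) w≢v)

  colour-in-othersAt : ∀ {k} (ec : EdgeColoring G k) α u v →
                       length (filter (λ w → col ec u w Fin.≟ α) (othersAt G u v)) ≤ colourDeg (col ec) α u
  colour-in-othersAt ec α u v = begin
    length (filter (λ w → col ec u w Fin.≟ α) (othersAt G u v))               ≡⟨ length-filter (λ w → col ec u w Fin.≟ α) (othersAt G u v) ⟩
    count (λ w → does (col ec u w Fin.≟ α)) (othersAt G u v)                  ≡⟨ count-filter (λ w → ¬? (w Fin.≟ v)) _ (neighbours G u) ⟩
    count (λ w → not (does (w Fin.≟ v)) ∧ does (col ec u w Fin.≟ α)) (neighbours G u)
                                                                             ≤⟨ count-mono (neighbours G u) (λ _ → proj₂ ∘ ∧-true⁻) ⟩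
    colourDeg (col ec) α u                                                   ∎
    where open ≤-Reasoning

  strongMajority : ∀ {D t k} (ec : EdgeColoring G k) → Regular (suc D) G → 2 * (t + t) ≤ D + D →
                   (∀ u α → colourDeg (col ec) α u ≤ t) → StrongMajority G ec
  strongMajority {D} {t} ec regular budget bounded u v uv α = begin
    2 * adjColCount G ec α u v   ≤⟨ *-monoʳ-≤ 2 (+-mono-≤ (≤-trans (colour-in-othersAt ec α u v) (bounded u α))
                                                          (≤-trans (colour-in-othersAt ec α v u) (bounded v α))) ⟩
    2 * (t + t)                  ≤⟨ budget ⟩
    D + D                        ≡⟨ cong₂ _+_ (others uv) (others (SimpleGraph.sym G uv)) ⟨
    adjCount G u v               ∎
    where
    open ≤-Reasoning
    others : ∀ {u v} → Adj G u v → length (othersAt G u v) ≡ D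
    others {u} uv = suc-injective (trans (length-othersAt uv) (regular u))

mainTheorem14 : (n : ℕ) (G : SimpleGraph n) → Regular 6 G → MajIndexAtMost G 3
mainTheorem14 n G regular =
  let c , c-col , twice = edgeColouringTwoPerVertex (graph G) 2 (indexOrder G) (indexOrder-orient G) (≤-reflexive ∘ regular)
  in edgeColoring G c c-col ,
     strongMajority G (edgeColoring G c c-col) regular (m≤m+n 8 2)
                    (λ u α → subst (_≤ 2) (sym (colourDeg-symmetrise G c c-col α u)) (twice u α))
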